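{- Let $k\ge2$, $m\ge0$ and $0\le l<k$, and let $\pi$ be a mod-$k$-alternating permutation of $[km+l]$ that avoids both $321$ and $132$. Then for every $j\in[m]$ the entries $k(j-1)+1, k(j-1)+2,\dots,kj$ appear in $\pi$ in this order in consecutive positions. Moreover, the entries $km+1,km+2,\dots,km+l$ appear in increasing order in the last $l$ positions of $\pi$.
   Context: A permutation $\pi$ of $[n]$ is mod-$k$-alternating if $\pi(i)\equiv i\pmod k$ for all $i$. A permutation contains a pattern $\sigma$ if some subsequence of its one-line notation is order-isomorphic to $\sigma$, and avoids it otherwise. -}

module Defs where

open import Data.Nat using (ℕ; _+_; _*_; _<_; _≤_; NonZero)
open import Data.Nat.DivMod using (_%_)
open import Data.Nat.Properties using (+-monoʳ-<; <-≤-trans)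
open import Data.Fin using (Fin; toℕ; fromℕ<)
open import Data.Fin.Properties using (toℕ<n)
open import Data.Fin.Permutation using (Permutation′; _⟨$⟩ʳ_)
open import Data.Product using (Σ; ∃; _×_)
open import Relation.Binary.PropositionalEquality using (_≡_)
open import Function.Bundles using (_⇔_)

-- Convention: [n] = {1,…,n} is represented by Fin n = {0,…,n-1}
-- (shift by one). A permutation of [n] is a bijection Fin n ↔ Fin n;
-- π(i) is  π ⟨$⟩ʳ i.

val : ∀ {n} → Permutation′ n → Fin n → ℕ
val π i = toℕ (π ⟨$⟩ʳ i)

-- mod-k-alternating: π(i) ≡ i (mod k) for all i
-- (invariant under the common shift by one of positions and values)
ModAlternating : (k : ℕ) .{{_ : NonZero k}} → ∀ {n} → Permutation′ n → Set
ModAlternating k π = ∀ i → val π i % k ≡ toℕ i % k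

Pattern : ℕ → Set
Pattern p = Fin p → ℕ

Contains : ∀ {n p} → Permutation′ n → Pattern p → Set
Contains {n} {p} π σ =
  Σ (Fin p → Fin n) λ f →
    (∀ a b → toℕ a < toℕ b → toℕ (f a) < toℕ (f b)) ×
    (∀ a b → (val π (f a) < val π (f b)) ⇔ (σ a < σ b))

Avoids : ∀ {n p} → Permutation′ n → Pattern p → Set
Avoids π σ = Contains π σ → Data.Empty.⊥
  where import Data.Empty

p321 : Pattern 3
p321 Fin.zero = 3
p321 (Fin.suc Fin.zero) = 2
p321 (Fin.suc (Fin.suc Fin.zero)) = 1
  where import Data.Fin as Fin

p132 : Pattern 3
p132 Fin.zero = 1
p132 (Fin.suc Fin.zero) = 3
p132 (Fin.suc (Fin.suc Fin.zero)) = 2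
  where import Data.Fin as Fin

blockPos : ∀ {n k} (s : ℕ) → s + k ≤ n → Fin k → Fin n
blockPos {n} {k} s h t = fromℕ< (<-≤-trans (+-monoʳ-< s (toℕ<n t)) h)

-- Avoiding 321 and 132 forces every descent of π to land on the value 0, and
-- forces every value w + 1 that stands before w to sit at position 0. Under
-- the mod-k condition both situations make k divide w + 1, w the value just
-- before the descent. So if k ∤ w + 1, then w + 1 lies after w, and the entry
-- directly after w is neither below w (a descent) nor above w + 1 (a 132):
-- it is w + 1. Hence each block kj, …, kj + k − 1 occupies consecutive
-- positions. Likewise the maximum n − 1 is in the last position unless k ∣ n,
-- which places the trailing run km, …, km + l − 1 at the end.
module Submission where

open import Defs
open import Data.Nat using (ℕ; zero; suc; _+_; _*_; _<_; _≤_; NonZero; z≤n; z<s; s<s; s≤s⁻¹; >-nonZero⁻¹)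
open import Data.Nat.Properties
open import Data.Nat.DivMod using (_%_; %-distribˡ-+; [m+kn]%n≡m%n; m<n⇒m%n≡m)
open import Data.Fin using (Fin; toℕ; fromℕ<; inject₁; _↑ʳ_) renaming (suc to fsuc)
open import Data.Fin.Patterns using (0F; 1F; 2F)
open import Data.Fin.Properties using (toℕ<n; toℕ-injective; toℕ-fromℕ<; toℕ-inject₁; toℕ-↑ʳ)
open import Data.Fin.Permutation using (Permutation′; _⟨$⟩ʳ_; _⟨$⟩ˡ_; inverseˡ; inverseʳ)
open import Data.Product using (Σ; ∃; _×_; _,_)
open import Data.Sum using (_⊎_; inj₁; inj₂; swap)
open import Data.Empty using (⊥; ⊥-elim)
open import Function using (_∘_; const)
open import Function.Bundles using (_⇔_; mk⇔)
open import Relation.Nullary using (¬_)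
open import Relation.Binary using (tri<; tri≈; tri>)
open import Relation.Binary.PropositionalEquality
  using (_≡_; _≢_; refl; sym; trans; cong; subst; module ≡-Reasoning)

data Compare₂ (a z : ℕ) : Set where
  less    : z < a → Compare₂ a z
  equal₀  : z ≡ a → Compare₂ a z
  equal₁  : z ≡ suc a → Compare₂ a z
  greater : suc a < z → Compare₂ a z

compare₂ : ∀ a z → Compare₂ a z
compare₂ a z with <-cmp z a
... | tri< z<a _ _ = less z<a
... | tri≈ _ z≡a _ = equal₀ z≡a
... | tri> _ _ a<z with m≤n⇒m<n∨m≡n a<z
...   | inj₁ 1+a<z = greater 1+a<z
...   | inj₂ 1+a≡z = equal₁ (sym 1+a≡z)

predecessor : ∀ {n} (r : Fin n) → 0 < toℕ r → ∃ λ (y : Fin n) → toℕ r ≡ suc (toℕ y)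
predecessor (fsuc r) _ = inject₁ r , cong suc (sym (toℕ-inject₁ r))

successor : ∀ {n} (q : Fin n) → suc (toℕ q) < n → ∃ λ (x : Fin n) → toℕ x ≡ suc (toℕ q)
successor q q+1<n = fromℕ< q+1<n , toℕ-fromℕ< q+1<n

%-cong-suc : ∀ k .{{_ : NonZero k}} {a b} → a % k ≡ b % k → suc a % k ≡ suc b % k
%-cong-suc k {a} {b} eq = begin
  (1 + a) % k                ≡⟨ %-distribˡ-+ 1 a k ⟩
  (1 % k + a % k) % k        ≡⟨ cong (λ c → (1 % k + c) % k) eq ⟩
  (1 % k + b % k) % k        ≡⟨ %-distribˡ-+ 1 b k ⟨
  (1 + b) % k                ∎
  where open ≡-Reasoning

[k*a+x]%k≡x : ∀ k .{{_ : NonZero k}} a {x} → x < k → (k * a + x) % k ≡ x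
[k*a+x]%k≡x k a {x} x<k = begin
  (k * a + x) % k   ≡⟨ cong (_% k) (trans (+-comm (k * a) x) (cong (x +_) (*-comm k a))) ⟩
  (x + a * k) % k   ≡⟨ [m+kn]%n≡m%n x a k ⟩
  x % k             ≡⟨ m<n⇒m%n≡m x<k ⟩
  x                 ∎
  where open ≡-Reasoning

[1+k*a+t]%k≢0 : ∀ k .{{_ : NonZero k}} a {t} → suc t < k → suc (k * a + t) % k ≢ 0
[1+k*a+t]%k≢0 k a {t} t+1<k eq = 1+n≢0 (begin
  suc t                 ≡⟨ [k*a+x]%k≡x k a t+1<k ⟨
  (k * a + suc t) % k   ≡⟨ cong (_% k) (+-suc (k * a) t) ⟩
  suc (k * a + t) % k   ≡⟨ eq ⟩
  0                     ∎)
  where open ≡-Reasoning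

block-bound : ∀ {k m j t} l → j < m → t < k → k * j + t < k * m + l
block-bound {k} {m} {j} {t} l j<m t<k = begin-strict
  k * j + t   <⟨ +-monoʳ-< (k * j) t<k ⟩
  k * j + k   ≡⟨ trans (+-comm (k * j) k) (sym (*-suc k j)) ⟩
  k * suc j   ≤⟨ *-monoʳ-≤ k j<m ⟩
  k * m       ≤⟨ m≤m+n (k * m) l ⟩
  k * m + l   ∎
  where open ≤-Reasoning

SameOrder : ℕ → ℕ → ℕ → ℕ → Set
SameOrder x y a b = (x < y × a < b) ⊎ (y < x × b < a)

sameOrder⇒⇔ : ∀ {x y a b} → SameOrder x y a b → (x < y) ⇔ (a < b)
sameOrder⇒⇔ (inj₁ (x<y , a<b)) = mk⇔ (const a<b) (const x<y)
sameOrder⇒⇔ (inj₂ (y<x , b<a)) = mk⇔ (⊥-elim ∘ <-asym y<x) (⊥-elim ∘ <-asym b<a)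

irrefl⇔ : ∀ {x a} → (x < x) ⇔ (a < a)
irrefl⇔ = mk⇔ (⊥-elim ∘ <-irrefl refl) (⊥-elim ∘ <-irrefl refl)

contains₃ : ∀ {n} (π : Permutation′ n) (σ : Pattern 3) {i j l : Fin n} →
  toℕ i < toℕ j → toℕ j < toℕ l →
  SameOrder (val π i) (val π j) (σ 0F) (σ 1F) →
  SameOrder (val π j) (val π l) (σ 1F) (σ 2F) →
  SameOrder (val π i) (val π l) (σ 0F) (σ 2F) →
  Contains π σ
contains₃ {n} π σ {i} {j} {l} i<j j<l o₀₁ o₁₂ o₀₂ = f , increasing , orderIso
  where
  f : Fin 3 → Fin n
  f 0F = i
  f 1F = j
  f 2F = l

  increasing : ∀ a b → toℕ a < toℕ b → toℕ (f a) < toℕ (f b)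
  increasing 0F 1F _ = i<j
  increasing 0F 2F _ = <-trans i<j j<l
  increasing 1F 2F _ = j<l
  increasing 0F 0F ()
  increasing 1F 0F ()
  increasing 1F 1F (s<s ())
  increasing 2F 0F ()
  increasing 2F 1F (s<s ())
  increasing 2F 2F (s<s (s<s ()))

  orderIso : ∀ a b → (val π (f a) < val π (f b)) ⇔ (σ a < σ b)
  orderIso 0F 0F = irrefl⇔
  orderIso 0F 1F = sameOrder⇒⇔ o₀₁
  orderIso 0F 2F = sameOrder⇒⇔ o₀₂
  orderIso 1F 0F = sameOrder⇒⇔ (swap o₀₁)
  orderIso 1F 1F = irrefl⇔
  orderIso 1F 2F = sameOrder⇒⇔ o₁₂
  orderIso 2F 0F = sameOrder⇒⇔ (swap o₀₂)
  orderIso 2F 1F = sameOrder⇒⇔ (swap o₁₂)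
  orderIso 2F 2F = irrefl⇔

module Avoiding {n} (π : Permutation′ n) (avoids321 : Avoids π p321) (avoids132 : Avoids π p132) where

  V : Fin n → ℕ
  V = val π

  V-injective : ∀ {i j} → V i ≡ V j → i ≡ j
  V-injective {i} {j} eq = begin
    i                       ≡⟨ inverseˡ π ⟨
    π ⟨$⟩ˡ (π ⟨$⟩ʳ i)      ≡⟨ cong (π ⟨$⟩ˡ_) (toℕ-injective eq) ⟩
    π ⟨$⟩ˡ (π ⟨$⟩ʳ j)      ≡⟨ inverseˡ π ⟩
    j                       ∎
    where open ≡-Reasoning

  toℕ≡⇒V≡ : ∀ {i j} → toℕ i ≡ toℕ j → V i ≡ V j
  toℕ≡⇒V≡ = cong V ∘ toℕ-injective

  V≡⇒toℕ≡ : ∀ {i j} → V i ≡ V j → toℕ i ≡ toℕ j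
  V≡⇒toℕ≡ = cong toℕ ∘ V-injective

  at : (w : ℕ) → w < n → Fin n
  at w w<n = π ⟨$⟩ˡ fromℕ< w<n

  V-at : ∀ {w} (w<n : w < n) → V (at w w<n) ≡ w
  V-at w<n = trans (cong toℕ (inverseʳ π)) (toℕ-fromℕ< w<n)

  no321 : ∀ {i j l} → toℕ i < toℕ j → toℕ j < toℕ l → V l < V j → V j < V i → ⊥
  no321 i<j j<l l<j j<i = avoids321 (contains₃ π p321 i<j j<l
    (inj₂ (j<i , n<1+n 2)) (inj₂ (l<j , n<1+n 1)) (inj₂ (<-trans l<j j<i , <-trans (n<1+n 1) (n<1+n 2))))

  no132 : ∀ {i j l} → toℕ i < toℕ j → toℕ j < toℕ l → V i < V l → V l < V j → ⊥
  no132 i<j j<l i<l l<j = avoids132 (contains₃ π p132 i<j j<l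
    (inj₁ (<-trans i<l l<j , <-trans (n<1+n 1) (n<1+n 2))) (inj₂ (l<j , n<1+n 2)) (inj₁ (i<l , n<1+n 1)))

  -- 0 before the descent completes 132, 0 after it completes 321.
  descent⇒zero : ∀ {q x} → toℕ x ≡ suc (toℕ q) → V x < V q → V x ≡ 0
  descent⇒zero {q} {x} x≡q+1 x<q = n≤0⇒n≡0 (≮⇒≥ positive-impossible)
    where
    0<n : 0 < n
    0<n = ≤-<-trans z≤n (toℕ<n q)

    z : Fin n
    z = at 0 0<n

    Vz≡0 : V z ≡ 0
    Vz≡0 = V-at 0<n

    positive-impossible : ¬ 0 < V x
    positive-impossible 0<x with compare₂ (toℕ q) (toℕ z)
    ... | less z<q = no132 z<q (≤-reflexive (sym x≡q+1)) (subst (_< V x) (sym Vz≡0) 0<x) x<q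
    ... | equal₀ z≡q = <-asym x<q (subst (_< V x) (trans (sym Vz≡0) (toℕ≡⇒V≡ z≡q)) 0<x)
    ... | equal₁ z≡q+1 = <⇒≢ 0<x (trans (sym Vz≡0) (toℕ≡⇒V≡ (trans z≡q+1 (sym x≡q+1))))
    ... | greater q+1<z = no321 (≤-reflexive (sym x≡q+1)) (subst (_< toℕ z) (sym x≡q+1) q+1<z)
                            (subst (_< V x) (sym Vz≡0) 0<x) x<q

  -- The entry just before w + 1 completes 132 if it is below w and 321 if it is above w + 1.
  inversion⇒zero : ∀ {q r} → V r ≡ suc (V q) → toℕ r < toℕ q → toℕ r ≡ 0
  inversion⇒zero {q} {r} r≡q+1 r<q = n≤0⇒n≡0 (≮⇒≥ positive-impossible)
    where
    positive-impossible : ¬ 0 < toℕ r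
    positive-impossible 0<r with predecessor r 0<r
    ... | y , r≡y+1 with compare₂ (V q) (V y)
    ...   | less y<q = no132 (≤-reflexive (sym r≡y+1)) r<q y<q (subst (V q <_) (sym r≡q+1) (n<1+n (V q)))
    ...   | equal₀ y≡q = <-asym (≤-reflexive (sym r≡y+1)) (subst (toℕ r <_) (sym (V≡⇒toℕ≡ y≡q)) r<q)
    ...   | equal₁ y≡q+1 = <⇒≢ (≤-reflexive (sym r≡y+1)) (V≡⇒toℕ≡ (trans y≡q+1 (sym r≡q+1)))
    ...   | greater q+1<y = no321 (≤-reflexive (sym r≡y+1)) r<q
                              (subst (V q <_) (sym r≡q+1) (n<1+n (V q))) (subst (_< V y) (sym r≡q+1) q+1<y)

module Alternating {n} (k : ℕ) .{{_ : NonZero k}} (π : Permutation′ n) (alternating : ModAlternating k π)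
  (avoids321 : Avoids π p321) (avoids132 : Avoids π p132) where

  open Avoiding π avoids321 avoids132 public

  0%k≡0 : 0 % k ≡ 0
  0%k≡0 = m<n⇒m%n≡m (>-nonZero⁻¹ k)

  descent⇒divides : ∀ {q x} → toℕ x ≡ suc (toℕ q) → V x < V q → suc (V q) % k ≡ 0
  descent⇒divides {q} {x} x≡q+1 x<q = begin
    suc (V q) % k       ≡⟨ %-cong-suc k (alternating q) ⟩
    suc (toℕ q) % k     ≡⟨ cong (_% k) (sym x≡q+1) ⟩
    toℕ x % k           ≡⟨ alternating x ⟨
    V x % k             ≡⟨ cong (_% k) (descent⇒zero x≡q+1 x<q) ⟩
    0 % k               ≡⟨ 0%k≡0 ⟩
    0                   ∎
    where open ≡-Reasoning

  inversion⇒divides : ∀ {q r} → V r ≡ suc (V q) → toℕ r < toℕ q → V r % k ≡ 0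
  inversion⇒divides {q} {r} r≡q+1 r<q = begin
    V r % k     ≡⟨ alternating r ⟩
    toℕ r % k   ≡⟨ cong (_% k) (inversion⇒zero r≡q+1 r<q) ⟩
    0 % k       ≡⟨ 0%k≡0 ⟩
    0           ∎
    where open ≡-Reasoning

  successor-adjacent : ∀ {q r} → V r ≡ suc (V q) → V r % k ≢ 0 → toℕ r ≡ suc (toℕ q)
  successor-adjacent {q} {r} r≡q+1 r≢0 with compare₂ (toℕ q) (toℕ r)
  ... | less r<q = ⊥-elim (r≢0 (inversion⇒divides r≡q+1 r<q))
  ... | equal₀ r≡q = ⊥-elim (<⇒≢ (n<1+n (V q)) (trans (sym (toℕ≡⇒V≡ r≡q)) r≡q+1))
  ... | equal₁ r≡q+1′ = r≡q+1′
  ... | greater q+1<r with successor q (<-trans q+1<r (toℕ<n r))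
  ...   | x , x≡q+1 with compare₂ (V q) (V x)
  ...     | less x<q = ⊥-elim (r≢0 (trans (cong (_% k) r≡q+1) (descent⇒divides x≡q+1 x<q)))
  ...     | equal₀ x≡q = ⊥-elim (<⇒≢ (n<1+n (toℕ q)) (sym (trans (sym x≡q+1) (V≡⇒toℕ≡ x≡q))))
  ...     | equal₁ x≡q+1′ = trans (V≡⇒toℕ≡ (trans r≡q+1 (sym x≡q+1′))) x≡q+1
  ...     | greater q+1<x = ⊥-elim (no132 (≤-reflexive (sym x≡q+1)) (subst (_< toℕ r) (sym x≡q+1) q+1<r)
                              (subst (V q <_) (sym r≡q+1) (n<1+n (V q))) (subst (_< V x) (sym r≡q+1) q+1<x))

  consecutive-run : ∀ q r w t → V q ≡ w → V r ≡ w + t →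
    (∀ {t′} → t′ < t → suc (w + t′) % k ≢ 0) → toℕ r ≡ toℕ q + t
  consecutive-run q r w zero q≡w r≡w _ =
    trans (V≡⇒toℕ≡ (trans r≡w (trans (+-identityʳ w) (sym q≡w)))) (sym (+-identityʳ (toℕ q)))
  consecutive-run q r w (suc t) q≡w r≡w+t+1 no-multiple = begin
    toℕ r                 ≡⟨ successor-adjacent r≡r′+1 r%k≢0 ⟩
    suc (toℕ r′)          ≡⟨ cong suc (consecutive-run q r′ w t q≡w (V-at w+t<n) (no-multiple ∘ m<n⇒m<1+n)) ⟩
    suc (toℕ q + t)       ≡⟨ +-suc (toℕ q) t ⟨
    toℕ q + suc t         ∎
    where
    open ≡-Reasoning
    r≡w+t+1′ : V r ≡ suc (w + t)
    r≡w+t+1′ = trans r≡w+t+1 (+-suc w t)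
    w+t<n : w + t < n
    w+t<n = <-trans (subst (w + t <_) (sym r≡w+t+1′) (n<1+n (w + t))) (toℕ<n (π ⟨$⟩ʳ r))
    r′ : Fin n
    r′ = at (w + t) w+t<n
    r≡r′+1 : V r ≡ suc (V r′)
    r≡r′+1 = trans r≡w+t+1′ (cong suc (sym (V-at w+t<n)))
    r%k≢0 : V r % k ≢ 0
    r%k≢0 = subst (λ v → v % k ≢ 0) (sym r≡w+t+1′) (no-multiple (n<1+n t))

  maximum-last : n % k ≢ 0 → ∀ {z} → suc (V z) ≡ n → suc (toℕ z) ≡ n
  maximum-last n≢0 {z} z≡n-1 with m≤n⇒m<n∨m≡n (toℕ<n z)
  ... | inj₂ z+1≡n = z+1≡n
  ... | inj₁ z+1<n with successor z z+1<n
  ...   | x , x≡z+1 = ⊥-elim (n≢0 (subst (λ v → v % k ≡ 0) z≡n-1 (descent⇒divides x≡z+1 x<z)))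
    where
    x<z : V x < V z
    x<z = ≤∧≢⇒< (s≤s⁻¹ (subst (V x <_) (sym z≡n-1) (toℕ<n (π ⟨$⟩ʳ x))))
                 (λ x≡z → <⇒≢ (n<1+n (toℕ z)) (sym (trans (sym x≡z+1) (V≡⇒toℕ≡ x≡z))))

blocks-consecutive : ∀ k .{{_ : NonZero k}} m l (π : Permutation′ (k * m + l)) →
  ModAlternating k π → Avoids π p321 → Avoids π p132 →
  ∀ j → j < m →
    Σ ℕ λ s → Σ (s + k ≤ k * m + l) λ h →
      ∀ (t : Fin k) → val π (blockPos s h t) ≡ k * j + toℕ t
blocks-consecutive k@(suc k₁) m l π alternating avoids321 avoids132 j j<m = s , s+k≤n , block-entry
  where
  open Alternating k π alternating avoids321 avoids132

  entry : ∀ t → t < k → Fin (k * m + l)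
  entry t t<k = at (k * j + t) (block-bound l j<m t<k)

  V-entry : ∀ t (t<k : t < k) → V (entry t t<k) ≡ k * j + t
  V-entry t t<k = V-at (block-bound l j<m t<k)

  s : ℕ
  s = toℕ (entry 0 z<s)

  entry-position : ∀ t (t<k : t < k) → toℕ (entry t t<k) ≡ s + t
  entry-position t t<k = consecutive-run (entry 0 z<s) (entry t t<k) (k * j) t
    (trans (V-entry 0 z<s) (+-identityʳ (k * j))) (V-entry t t<k)
    (λ t′<t → [1+k*a+t]%k≢0 k j (<-≤-trans (s<s t′<t) t<k))

  s+k≤n : s + k ≤ k * m + l
  s+k≤n = subst (_≤ k * m + l) (trans (cong suc (entry-position k₁ ≤-refl)) (sym (+-suc s k₁)))
                (toℕ<n (entry k₁ ≤-refl))

  block-entry : ∀ (t : Fin k) → val π (blockPos s s+k≤n t) ≡ k * j + toℕ t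
  block-entry t = trans (cong V (toℕ-injective (trans (toℕ-fromℕ< _) (sym (entry-position (toℕ t) (toℕ<n t))))))
                        (V-entry (toℕ t) (toℕ<n t))

trailing-sorted : ∀ k .{{_ : NonZero k}} m l → l < k → (π : Permutation′ (k * m + l)) →
  ModAlternating k π → Avoids π p321 → Avoids π p132 →
  ∀ (t : Fin l) → val π ((k * m) ↑ʳ t) ≡ k * m + toℕ t
trailing-sorted k m zero _ π _ _ _ ()
trailing-sorted k m (suc d) l<k π alternating avoids321 avoids132 t = begin
  V ((k * m) ↑ʳ t)             ≡⟨ toℕ≡⇒V≡ (trans (toℕ-↑ʳ (k * m) t) (sym (entry-position (toℕ t) (toℕ<n t)))) ⟩
  V (entry (toℕ t) (toℕ<n t))   ≡⟨ V-entry (toℕ t) (toℕ<n t) ⟩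
  k * m + toℕ t                 ∎
  where
  open ≡-Reasoning
  open Alternating k π alternating avoids321 avoids132

  entry : ∀ t → t < suc d → Fin (k * m + suc d)
  entry t t≤d = at (k * m + t) (+-monoʳ-< (k * m) t≤d)

  V-entry : ∀ t (t≤d : t < suc d) → V (entry t t≤d) ≡ k * m + t
  V-entry t t≤d = V-at (+-monoʳ-< (k * m) t≤d)

  entry-offset : ∀ t (t≤d : t < suc d) → toℕ (entry t t≤d) ≡ toℕ (entry 0 z<s) + t
  entry-offset t t≤d = consecutive-run (entry 0 z<s) (entry t t≤d) (k * m) t
    (trans (V-entry 0 z<s) (+-identityʳ (k * m))) (V-entry t t≤d)
    (λ t′<t → [1+k*a+t]%k≢0 k m (<-trans (s<s (<-≤-trans t′<t (s≤s⁻¹ t≤d))) l<k))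

  n%k≢0 : (k * m + suc d) % k ≢ 0
  n%k≢0 = 1+n≢0 ∘ trans (sym ([k*a+x]%k≡x k m l<k))

  run-starts-at-km : toℕ (entry 0 z<s) ≡ k * m
  run-starts-at-km = +-cancelʳ-≡ d _ _ (suc-injective (begin
    suc (toℕ (entry 0 z<s) + d)   ≡⟨ cong suc (entry-offset d ≤-refl) ⟨
    suc (toℕ (entry d ≤-refl))    ≡⟨ maximum-last n%k≢0 (trans (cong suc (V-entry d ≤-refl)) (sym (+-suc (k * m) d))) ⟩
    k * m + suc d                 ≡⟨ +-suc (k * m) d ⟩
    suc (k * m + d)               ∎))

  entry-position : ∀ t (t≤d : t < suc d) → toℕ (entry t t≤d) ≡ k * m + t
  entry-position t t≤d = trans (entry-offset t t≤d) (cong (_+ t) run-starts-at-km)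

mainTheorem18 : (k m l : ℕ) .{{_ : NonZero k}} → 2 ≤ k → l < k →
    (π : Permutation′ (k * m + l)) →
    ModAlternating k π → Avoids π p321 → Avoids π p132 →
    (∀ (j : ℕ) → j < m →
    Σ ℕ λ s → Σ (s + k ≤ k * m + l) λ h →
    ∀ (t : Fin k) → val π (blockPos s h t) ≡ k * j + toℕ t)
    × (∀ (t : Fin l) → val π ((k * m) ↑ʳ t) ≡ k * m + toℕ t)
mainTheorem18 k m l _ l<k π alternating avoids321 avoids132 =
  blocks-consecutive k m l π alternating avoids321 avoids132 ,
  trailing-sorted k m l l<k π alternating avoids321 avoids132
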